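{- (i) For all contexts $\Gamma,\Delta$: if $\Gamma\approx_\alpha\Delta$ and $\Gamma\ \mathrm{ok}$, then $\Delta\ \mathrm{ok}$. (ii) For all contexts $\Gamma,\Delta$ and terms $M,N,A$: if $\Gamma\approx_\alpha\Delta$, $M\sim_\alpha N$ and $\Gamma\vdash M:A$, then $\Delta\vdash N:A$.
   Context: Variables $\mathcal{V}$: a type with decidable equality and maps $\mathrm{encode}:\mathcal{V}\to\mathbb{N}$, $\mathrm{decode}:\mathbb{N}\to\mathcal{V}$ with $\mathrm{encode}(\mathrm{decode}\,n)=n$. Constants $\mathcal{C}$: any type. Terms: $\mathsf{c}\,k$, $\mathsf{v}\,x$, $\lambda[x:A]M$, $\Pi[x:A]B$, $M\cdot N$. Free-variable list: $\mathrm{fv}(\mathsf{c}\,k)=[\,]$, $\mathrm{fv}(\mathsf{v}\,x)=[x]$, $\mathrm{fv}(\lambda[x:A]M)=\mathrm{fv}\,A\mathbin{++}(\mathrm{fv}\,M-x)$, likewise $\Pi$, $\mathrm{fv}(M\cdot N)=\mathrm{fv}\,M\mathbin{++}\mathrm{fv}\,N$ ($xs-x$ removes all occurrences of $x$). Substitutions $\sigma:\mathcal{V}\to\Lambda$; $\iota\,x=\mathsf{v}\,x$; $(\sigma,x:=N)$ sends $x$ to $N$, $y\neq x$ to $\sigma\,y$. Fix $\chi':\mathrm{List}\,\mathbb{N}\to\mathbb{N}$ with $\chi'(ns)\notin ns$; $X'(xs)=\mathrm{decode}(\chi'(\mathrm{map\ encode}\ xs))$; $X(\sigma,xs)=X'$(concatenation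 of $\mathrm{fv}(\sigma\,y)$ for $y$ in $xs$). Substitution: $\mathsf{c}\,k\bullet\sigma=\mathsf{c}\,k$, $\mathsf{v}\,x\bullet\sigma=\sigma\,x$, $(M\cdot N)\bullet\sigma=(M\bullet\sigma)\cdot(N\bullet\sigma)$, $(\lambda[x:A]M)\bullet\sigma=\lambda[y:A\bullet\sigma](M\bullet(\sigma,x:=\mathsf{v}\,y))$ with $y=X(\sigma,\mathrm{fv}\,M-x)$, analogously for $\Pi$ (with $y=X(\sigma,\mathrm{fv}\,B-x)$). $M[x:=N]=M\bullet(\iota,x:=N)$. Alpha-conversion $\sim_\alpha$: inductive, $\mathsf{c}\,k\sim_\alpha\mathsf{c}\,k$, $\mathsf{v}\,x\sim_\alpha\mathsf{v}\,x$, congruence for application, and $\lambda[x:A]M\sim_\alpha\lambda[x':A']M'$ whenever $A\sim_\alpha A'$, $y\notin\mathrm{fv}\,M-x$, $y\notin\mathrm{fv}\,M'-x'$ and $M[x:=\mathsf{v}\,y]=M'[x':=\mathsf{v}\,y]$ syntactically, for some $y$ (same for $\Pi$). Beta: the contextual closure of a relation $S$ is the least relation containing $S$ and closed under rewriting in the body or annotation of $\lambda$, in the codomain or domain of $\Pi$, and in either side of an application; $\to_\beta$ is the contextual closure of $(\lambda[x:A]M)\cdot N\ \triangleright\ M[x:=N]$; $\simeq_\beta$ is the reflexive–symmetric–transitive closure of $\sim_\alpha\cup\to_\beta$. PTS: fix $\mathcal{A}\subseteq\mathcal{C}^2$ (axioms) and $\mathcal{R}\subseteq\mathcal{C}^3$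 (rules). A context is a list of pairs $(x,A)$; $\Gamma,x:A$ denotes $(x,A)::\Gamma$; $\mathrm{dom}\,\Gamma$ is the list of first components. $\Gamma\approx_\alpha\Delta$ means $\Gamma$ and $\Delta$ have the same length and their entries are pointwise related: the $i$-th entries $(x,A)$ of $\Gamma$ and $(y,B)$ of $\Delta$ satisfy $x=y$ and $A\sim_\alpha B$. The judgments $\Gamma\ \mathrm{ok}$ and $\Gamma\vdash M:A$ are mutually inductively defined by: (nil) $[\,]\ \mathrm{ok}$; (cons) if $\Gamma\ \mathrm{ok}$, $\Gamma\vdash A:\mathsf{c}\,s$ and $x\notin\mathrm{dom}\,\Gamma$ then $(\Gamma,x:A)\ \mathrm{ok}$; (sort) if $\Gamma\ \mathrm{ok}$ and $\mathcal{A}\,s_1\,s_2$ then $\Gamma\vdash\mathsf{c}\,s_1:\mathsf{c}\,s_2$; (prod) if $\Gamma\vdash A:\mathsf{c}\,s_1$, for every $y\notin\mathrm{dom}\,\Gamma$ we have $\Gamma,y:A\vdash B[x:=\mathsf{v}\,y]:\mathsf{c}\,s_2$, and $\mathcal{R}\,s_1\,s_2\,s_3$, then $\Gamma\vdash\Pi[x:A]B:\mathsf{c}\,s_3$; (var) if $\Gamma\ \mathrm{ok}$ and $(x,A)\in\Gamma$ then $\Gamma\vdash\mathsf{v}\,x:A$; (abs) if $\Gamma\vdash A:\mathsf{c}\,s_1$, for every $z\notin\mathrm{dom}\,\Gamma$ both $\Gamma,z:A\vdash B[y:=\mathsf{v}\,z]:\mathsf{c}\,s_2$ and $\Gamma,z:A\vdash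 M[x:=\mathsf{v}\,z]:B[y:=\mathsf{v}\,z]$, and $\mathcal{R}\,s_1\,s_2\,s_3$, then $\Gamma\vdash\lambda[x:A]M:\Pi[y:A]B$; (app) if $\Gamma\vdash M:\Pi[x:A]B$, $\Gamma\vdash N:A$ and $\Gamma\vdash B[x:=N]:\mathsf{c}\,s$, then $\Gamma\vdash M\cdot N:B[x:=N]$; (conv) if $\Gamma\vdash M:A$, $A\simeq_\beta B$ and $\Gamma\vdash B:\mathsf{c}\,s$ then $\Gamma\vdash M:B$. -}

module Defs where

open import Data.Nat using (ℕ)
open import Agda.Primitive using (lzero)
open import Data.List using (List; []; _∷_; _++_; map)
open import Data.List.Membership.Propositional using (_∈_; _∉_)
open import Data.List.Relation.Binary.Pointwise using (Pointwise)
open import Data.Product using (_×_; _,_; proj₁)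
open import Data.Sum using (_⊎_)
open import Relation.Nullary using (Dec; yes; no)
open import Relation.Binary using (Rel; DecidableEquality)
open import Relation.Binary.PropositionalEquality using (_≡_)
open import Relation.Binary.Construct.Closure.Equivalence using (EqClosure)

record Setting : Set₁ where
  field
    V       : Set
    _≟V_    : DecidableEquality V
    encode  : V → ℕ
    decode  : ℕ → V
    enc-dec : ∀ n → encode (decode n) ≡ n
    C       : Set
    χ'      : List ℕ → ℕ
    χ'-fresh : ∀ ns → χ' ns ∉ ns
    Ax      : C → C → Set
    Rl      : C → C → C → Set

module PTS (S : Setting) where
  open Setting S

  data Term : Set where
    c   : C → Term
    v   : V → Term
    lam : V → Term → Term → Term        -- λ[x:A]M  as  lam x A M
    pi  : V → Term → Term → Term        -- Π[x:A]B  as  pi x A B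
    app : Term → Term → Term

  _-_ : List V → V → List V
  [] - x = []
  (y ∷ ys) - x with y ≟V x
  ... | yes _ = ys - x
  ... | no  _ = y ∷ (ys - x)

  fv : Term → List V
  fv (c k) = []
  fv (v x) = x ∷ []
  fv (lam x A M) = fv A ++ (fv M - x)
  fv (pi x A B) = fv A ++ (fv B - x)
  fv (app M N) = fv M ++ fv N

  Subst : Set
  Subst = V → Term

  ι : Subst
  ι x = v x

  _,_:=_ : Subst → V → Term → Subst
  (σ , x := N) y with y ≟V x
  ... | yes _ = N
  ... | no  _ = σ y

  X' : List V → V
  X' xs = decode (χ' (map encode xs))

  concatFv : Subst → List V → List V
  concatFv σ [] = []
  concatFv σ (y ∷ ys) = fv (σ y) ++ concatFv σ ys

  X : Subst → List V → V
  X σ xs = X' (concatFv σ xs)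

  _∙_ : Term → Subst → Term
  c k ∙ σ = c k
  v x ∙ σ = σ x
  app M N ∙ σ = app (M ∙ σ) (N ∙ σ)
  lam x A M ∙ σ =
    let y = X σ (fv M - x) in lam y (A ∙ σ) (M ∙ (σ , x := v y))
  pi x A B ∙ σ =
    let y = X σ (fv B - x) in pi y (A ∙ σ) (B ∙ (σ , x := v y))

  _[_:=_] : Term → V → Term → Term
  M [ x := N ] = M ∙ (ι , x := N)

  data _∼α_ : Term → Term → Set where
    α-c   : ∀ k → c k ∼α c k
    α-v   : ∀ x → v x ∼α v x
    α-app : ∀ {M M' N N'} → M ∼α M' → N ∼α N' → app M N ∼α app M' N'
    α-lam : ∀ {x x' A A' M M'} y → A ∼α A' → y ∉ (fv M - x) → y ∉ (fv M' - x')
          → M [ x := v y ] ≡ M' [ x' := v y ] → lam x A M ∼α lam x' A' M'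
    α-pi  : ∀ {x x' A A' B B'} y → A ∼α A' → y ∉ (fv B - x) → y ∉ (fv B' - x')
          → B [ x := v y ] ≡ B' [ x' := v y ] → pi x A B ∼α pi x' A' B'

  data Ctxt (R : Rel Term lzero) : Rel Term lzero where
    base   : ∀ {M N} → R M N → Ctxt R M N
    lam-b  : ∀ {x A M M'} → Ctxt R M M' → Ctxt R (lam x A M) (lam x A M')
    lam-a  : ∀ {x A A' M} → Ctxt R A A' → Ctxt R (lam x A M) (lam x A' M)
    pi-b   : ∀ {x A B B'} → Ctxt R B B' → Ctxt R (pi x A B) (pi x A B')
    pi-a   : ∀ {x A A' B} → Ctxt R A A' → Ctxt R (pi x A B) (pi x A' B)
    app-l  : ∀ {M M' N} → Ctxt R M M' → Ctxt R (app M N) (app M' N)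
    app-r  : ∀ {M N N'} → Ctxt R N N' → Ctxt R (app M N) (app M N')

  data βroot : Rel Term lzero where
    β : ∀ x A M N → βroot (app (lam x A M) N) (M [ x := N ])

  _→β_ : Rel Term lzero
  _→β_ = Ctxt βroot

  αβ : Rel Term lzero
  αβ M N = (M ∼α N) ⊎ (M →β N)

  _≃β_ : Rel Term lzero
  _≃β_ = EqClosure αβ

  Context : Set
  Context = List (V × Term)

  dom : Context → List V
  dom = map proj₁

  _≈α_ : Context → Context → Set
  _≈α_ = Pointwise (λ p q → (proj₁ p ≡ proj₁ q) × (Data.Product.proj₂ p ∼α Data.Product.proj₂ q))

  mutual
    data _ok : Context → Set where
      nil  : [] ok
      cons : ∀ {Γ x A s} → Γ ok → Γ ⊢ A ∶ c s → x ∉ dom Γ → ((x , A) ∷ Γ) ok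

    data _⊢_∶_ : Context → Term → Term → Set where
      sort : ∀ {Γ s₁ s₂} → Γ ok → Ax s₁ s₂ → Γ ⊢ c s₁ ∶ c s₂
      prod : ∀ {Γ x A B s₁ s₂ s₃} → Γ ⊢ A ∶ c s₁
           → (∀ y → y ∉ dom Γ → ((y , A) ∷ Γ) ⊢ B [ x := v y ] ∶ c s₂)
           → Rl s₁ s₂ s₃ → Γ ⊢ pi x A B ∶ c s₃
      var  : ∀ {Γ x A} → Γ ok → (x , A) ∈ Γ → Γ ⊢ v x ∶ A
      abs  : ∀ {Γ x y A B M s₁ s₂ s₃} → Γ ⊢ A ∶ c s₁
           → (∀ z → z ∉ dom Γ → ((z , A) ∷ Γ) ⊢ B [ y := v z ] ∶ c s₂)
           → (∀ z → z ∉ dom Γ → ((z , A) ∷ Γ) ⊢ M [ x := v z ] ∶ (B [ y := v z ]))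
           → Rl s₁ s₂ s₃ → Γ ⊢ lam x A M ∶ pi y A B
      appT : ∀ {Γ M N x A B s} → Γ ⊢ M ∶ pi x A B → Γ ⊢ N ∶ A
           → Γ ⊢ B [ x := N ] ∶ c s → Γ ⊢ app M N ∶ (B [ x := N ])
      conv : ∀ {Γ M A B s} → Γ ⊢ M ∶ A → A ≃β B → Γ ⊢ B ∶ c s → Γ ⊢ M ∶ B

-- Alpha-conversion is exactly equality after substituting the identity, M ∼α N ⇔ M ∙ ι ≡ N ∙ ι,
-- because substitution always renames binders to a name chosen from the free variables of the
-- substituted body alone. Hence every judgement is stable under α-renaming of its subject and of
-- the context, by induction on the derivation; the only conversion needed is the α-step between a
-- type and its renamed copy, which is an instance of the conversion rule.
module Submission where

open import Defs
open import Data.Product using (_×_; _,_; proj₁; ∃-syntax; map₁; map₂)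
open import Data.Sum using (inj₁)
open import Data.Empty using (⊥-elim)
open import Data.List using ([]; _∷_; _++_; map)
open import Data.List.Properties using (++-identityʳ; ++-assoc)
open import Data.List.Relation.Unary.Any using (here; there)
open import Data.List.Membership.Propositional using (_∈_; _∉_)
open import Data.List.Membership.Propositional.Properties using (∈-map⁺; ∈-++⁺ˡ; ∈-++⁺ʳ)
open import Data.List.Relation.Binary.Subset.Propositional using (_⊆_)
open import Data.List.Relation.Binary.Subset.Propositional.Properties using (map⁺; ∷⁺ʳ)
open import Data.List.Relation.Binary.Pointwise using ([]; _∷_)
open import Relation.Nullary using (yes; no)
open import Relation.Binary.PropositionalEquality
  using (_≡_; _≢_; refl; sym; trans; cong; cong₂; subst; module ≡-Reasoning)
open import Relation.Binary.Construct.Closure.Equivalence using (return)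

cong₃ : ∀ {a b c d} {A : Set a} {B : Set b} {C : Set c} {D : Set d}
        (f : A → B → C → D) {x x' y y' z z'} →
        x ≡ x' → y ≡ y' → z ≡ z' → f x y z ≡ f x' y' z'
cong₃ f refl refl refl = refl

module AlphaInvariance (S : Setting) where
  open Setting S
  open PTS S
  open ≡-Reasoning

  private variable
    Γ Δ : Context
    M N A : Term

  fresh : Subst → V → Term → V
  fresh σ x M = X σ (fv M - x)

  lift : Subst → V → Term → Subst
  lift σ x M = σ , x := v (fresh σ x M)

  remove-++ : ∀ xs ys x → (xs ++ ys) - x ≡ (xs - x) ++ (ys - x)
  remove-++ [] ys x = refl
  remove-++ (y ∷ xs) ys x with y ≟V x
  ... | yes _ = remove-++ xs ys x
  ... | no  _ = cong (y ∷_) (remove-++ xs ys x)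

  remove-∉ : ∀ xs x → x ∉ xs → xs - x ≡ xs
  remove-∉ [] x x∉ = refl
  remove-∉ (y ∷ xs) x x∉ with y ≟V x
  ... | yes refl = ⊥-elim (x∉ (here refl))
  ... | no  _    = cong (y ∷_) (remove-∉ xs x (λ x∈ → x∉ (there x∈)))

  remove-head : ∀ xs x → (x ∷ xs) - x ≡ xs - x
  remove-head xs x with x ≟V x
  ... | yes _   = refl
  ... | no  x≢x = ⊥-elim (x≢x refl)

  ∈-remove : ∀ {u} xs x → u ∈ xs → u ≢ x → u ∈ xs - x
  ∈-remove (y ∷ xs) x (here refl) u≢x with y ≟V x
  ... | yes u≡x = ⊥-elim (u≢x u≡x)
  ... | no  _   = here refl
  ∈-remove (y ∷ xs) x (there u∈) u≢x with y ≟V x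
  ... | yes _ = ∈-remove xs x u∈ u≢x
  ... | no  _ = there (∈-remove xs x u∈ u≢x)

  update-≡ : ∀ σ x N → (σ , x := N) x ≡ N
  update-≡ σ x N with x ≟V x
  ... | yes _   = refl
  ... | no  x≢x = ⊥-elim (x≢x refl)

  update-≢ : ∀ σ x N {u} → u ≢ x → (σ , x := N) u ≡ σ u
  update-≢ σ x N {u} u≢x with u ≟V x
  ... | yes u≡x = ⊥-elim (u≢x u≡x)
  ... | no  _   = refl

  update-cong : ∀ σ τ x N u → (u ≢ x → σ u ≡ τ u) → (σ , x := N) u ≡ (τ , x := N) u
  update-cong σ τ x N u eq with u ≟V x
  ... | yes _   = refl
  ... | no  u≢x = eq u≢x

  X'-∉ : ∀ xs → X' xs ∉ xs
  X'-∉ xs X'∈ = χ'-fresh (map encode xs)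
    (subst (_∈ map encode xs) (enc-dec (χ' (map encode xs))) (∈-map⁺ encode X'∈))

  concatFv-++ : ∀ σ xs ys → concatFv σ (xs ++ ys) ≡ concatFv σ xs ++ concatFv σ ys
  concatFv-++ σ [] ys = refl
  concatFv-++ σ (y ∷ xs) ys = begin
    fv (σ y) ++ concatFv σ (xs ++ ys)              ≡⟨ cong (fv (σ y) ++_) (concatFv-++ σ xs ys) ⟩
    fv (σ y) ++ (concatFv σ xs ++ concatFv σ ys)   ≡⟨ ++-assoc (fv (σ y)) _ _ ⟨
    (fv (σ y) ++ concatFv σ xs) ++ concatFv σ ys   ∎

  concatFv-ι : ∀ xs → concatFv ι xs ≡ xs
  concatFv-ι [] = refl
  concatFv-ι (y ∷ xs) = cong (y ∷_) (concatFv-ι xs)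

  concatFv-cong : ∀ σ τ xs → (∀ u → u ∈ xs → σ u ≡ τ u) → concatFv σ xs ≡ concatFv τ xs
  concatFv-cong σ τ [] eq = refl
  concatFv-cong σ τ (y ∷ xs) eq =
    cong₂ (λ t ys → fv t ++ ys) (eq y (here refl)) (concatFv-cong σ τ xs (λ u u∈ → eq u (there u∈)))

  concatFv-∈ : ∀ σ {u t} xs → u ∈ xs → t ∈ fv (σ u) → t ∈ concatFv σ xs
  concatFv-∈ σ (y ∷ xs) (here refl) t∈ = ∈-++⁺ˡ t∈
  concatFv-∈ σ (y ∷ xs) (there u∈) t∈ = ∈-++⁺ʳ (fv (σ y)) (concatFv-∈ σ xs u∈ t∈)

  concatFv-update : ∀ σ x y xs → y ∉ concatFv σ (xs - x) →
                    concatFv (σ , x := v y) xs - y ≡ concatFv σ (xs - x)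
  concatFv-update σ x y [] y∉ = refl
  concatFv-update σ x y (u ∷ xs) y∉ with u ≟V x
  ... | yes _ = trans (remove-head (concatFv (σ , x := v y) xs) y) (concatFv-update σ x y xs y∉)
  ... | no  _ =
    trans (remove-++ (fv (σ u)) (concatFv (σ , x := v y) xs) y)
          (cong₂ _++_ (remove-∉ (fv (σ u)) y (λ y∈ → y∉ (∈-++⁺ˡ y∈)))
                      (concatFv-update σ x y xs (λ y∈ → y∉ (∈-++⁺ʳ (fv (σ u)) y∈))))

  fresh-∉ : ∀ σ x M → fresh σ x M ∉ concatFv σ (fv M - x)
  fresh-∉ σ x M = X'-∉ _

  fresh-ι-∉ : ∀ x M → fresh ι x M ∉ fv M - x
  fresh-ι-∉ x M = subst (fresh ι x M ∉_) (concatFv-ι (fv M - x)) (fresh-∉ ι x M)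

  mutual
    fv-∙ : ∀ M σ → fv (M ∙ σ) ≡ concatFv σ (fv M)
    fv-∙ (c k) σ = refl
    fv-∙ (v x) σ = sym (++-identityʳ (fv (σ x)))
    fv-∙ (app M N) σ = trans (cong₂ _++_ (fv-∙ M σ) (fv-∙ N σ)) (sym (concatFv-++ σ (fv M) (fv N)))
    fv-∙ (lam x A M) σ =
      trans (cong₂ _++_ (fv-∙ A σ) (fv-lift M σ x)) (sym (concatFv-++ σ (fv A) (fv M - x)))
    fv-∙ (pi x A B) σ =
      trans (cong₂ _++_ (fv-∙ A σ) (fv-lift B σ x)) (sym (concatFv-++ σ (fv A) (fv B - x)))

    fv-lift : ∀ M σ x → fv (M ∙ lift σ x M) - fresh σ x M ≡ concatFv σ (fv M - x)
    fv-lift M σ x =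
      trans (cong (_- fresh σ x M) (fv-∙ M (lift σ x M)))
            (concatFv-update σ x _ (fv M) (fresh-∉ σ x M))

  fresh-cong : ∀ σ τ x M → (∀ u → u ∈ fv M - x → σ u ≡ τ u) → fresh σ x M ≡ fresh τ x M
  fresh-cong σ τ x M eq = cong X' (concatFv-cong σ τ (fv M - x) eq)

  mutual
    ∙-cong : ∀ M σ τ → (∀ u → u ∈ fv M → σ u ≡ τ u) → M ∙ σ ≡ M ∙ τ
    ∙-cong (c k) σ τ eq = refl
    ∙-cong (v x) σ τ eq = eq x (here refl)
    ∙-cong (app M N) σ τ eq =
      cong₂ app (∙-cong M σ τ (λ u u∈ → eq u (∈-++⁺ˡ u∈)))
                (∙-cong N σ τ (λ u u∈ → eq u (∈-++⁺ʳ (fv M) u∈)))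
    ∙-cong (lam x A M) σ τ eq =
      cong₃ lam (fresh-cong σ τ x M eqᴹ) (∙-cong A σ τ eqᴬ) (∙-lift-cong M σ τ x eqᴹ)
      where eqᴬ = λ u u∈ → eq u (∈-++⁺ˡ u∈)
            eqᴹ = λ u u∈ → eq u (∈-++⁺ʳ (fv A) u∈)
    ∙-cong (pi x A B) σ τ eq =
      cong₃ pi (fresh-cong σ τ x B eqᴮ) (∙-cong A σ τ eqᴬ) (∙-lift-cong B σ τ x eqᴮ)
      where eqᴬ = λ u u∈ → eq u (∈-++⁺ˡ u∈)
            eqᴮ = λ u u∈ → eq u (∈-++⁺ʳ (fv A) u∈)

    ∙-lift-cong : ∀ M σ τ x → (∀ u → u ∈ fv M - x → σ u ≡ τ u) → M ∙ lift σ x M ≡ M ∙ lift τ x M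
    ∙-lift-cong M σ τ x eq = begin
      M ∙ lift σ x M                      ≡⟨ ∙-cong M _ _ under-x ⟩
      M ∙ (τ , x := v (fresh σ x M))      ≡⟨ cong (λ y → M ∙ (τ , x := v y)) (fresh-cong σ τ x M eq) ⟩
      M ∙ lift τ x M                      ∎
      where
      under-x : ∀ u → u ∈ fv M → lift σ x M u ≡ (τ , x := v (fresh σ x M)) u
      under-x u u∈ = update-cong σ τ x _ u (λ u≢x → eq u (∈-remove (fv M) x u∈ u≢x))

  _⨟_ : Subst → Subst → Subst
  (σ ⨟ τ) u = σ u ∙ τ

  concatFv-⨟ : ∀ σ τ xs → concatFv τ (concatFv σ xs) ≡ concatFv (σ ⨟ τ) xs
  concatFv-⨟ σ τ [] = refl
  concatFv-⨟ σ τ (u ∷ xs) =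
    trans (concatFv-++ τ (fv (σ u)) (concatFv σ xs))
          (cong₂ _++_ (sym (fv-∙ (σ u) τ)) (concatFv-⨟ σ τ xs))

  fresh-⨟ : ∀ σ τ x M → fresh τ (fresh σ x M) (M ∙ lift σ x M) ≡ fresh (σ ⨟ τ) x M
  fresh-⨟ σ τ x M = cong X' (trans (cong (concatFv τ) (fv-lift M σ x)) (concatFv-⨟ σ τ (fv M - x)))

  -- The binder chosen by σ avoids every free variable of σ u for u free in the body.
  lift-⨟ : ∀ σ τ x M w u → u ∈ fv M →
           (lift σ x M ⨟ (τ , fresh σ x M := v w)) u ≡ ((σ ⨟ τ) , x := v w) u
  lift-⨟ σ τ x M w u u∈ with u ≟V x
  ... | yes _   = update-≡ τ (fresh σ x M) (v w)
  ... | no  u≢x = ∙-cong (σ u) _ _ λ t t∈ → update-≢ τ _ (v w) λ { refl →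
                    fresh-∉ σ x M (concatFv-∈ σ (fv M - x) (∈-remove (fv M) x u∈ u≢x) t∈) }

  mutual
    ∙-⨟ : ∀ M σ τ → (M ∙ σ) ∙ τ ≡ M ∙ (σ ⨟ τ)
    ∙-⨟ (c k) σ τ = refl
    ∙-⨟ (v x) σ τ = refl
    ∙-⨟ (app M N) σ τ = cong₂ app (∙-⨟ M σ τ) (∙-⨟ N σ τ)
    ∙-⨟ (lam x A M) σ τ = cong₃ lam (fresh-⨟ σ τ x M) (∙-⨟ A σ τ) (∙-lift-⨟ M σ τ x)
    ∙-⨟ (pi x A B) σ τ = cong₃ pi (fresh-⨟ σ τ x B) (∙-⨟ A σ τ) (∙-lift-⨟ B σ τ x)

    ∙-lift-⨟ : ∀ M σ τ x →
               (M ∙ lift σ x M) ∙ lift τ (fresh σ x M) (M ∙ lift σ x M) ≡ M ∙ lift (σ ⨟ τ) x M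
    ∙-lift-⨟ M σ τ x = begin
      Mσ ∙ lift τ y Mσ                    ≡⟨ cong (λ w → Mσ ∙ (τ , y := v w)) (fresh-⨟ σ τ x M) ⟩
      Mσ ∙ (τ , y := v w)                 ≡⟨ ∙-⨟ M _ _ ⟩
      M ∙ (lift σ x M ⨟ (τ , y := v w))   ≡⟨ ∙-cong M _ _ (lift-⨟ σ τ x M w) ⟩
      M ∙ lift (σ ⨟ τ) x M                ∎
      where y = fresh σ x M
            w = fresh (σ ⨟ τ) x M
            Mσ = M ∙ lift σ x M

  ∙-rename : ∀ M x w → w ∉ fv M - x → ∀ σ N → M ∙ (σ , x := N) ≡ (M [ x := v w ]) ∙ (σ , w := N)
  ∙-rename M x w w∉ σ N = trans (∙-cong M _ _ renamed) (sym (∙-⨟ M (ι , x := v w) (σ , w := N)))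
    where
    renamed : ∀ u → u ∈ fv M → (σ , x := N) u ≡ ((ι , x := v w) ⨟ (σ , w := N)) u
    renamed u u∈ with u ≟V x
    ... | yes _   = sym (update-≡ σ w N)
    ... | no  u≢x = sym (update-≢ σ w N λ { refl → w∉ (∈-remove (fv M) x u∈ u≢x) })

  fv-rename : ∀ M x w → w ∉ fv M - x → fv (M [ x := v w ]) - w ≡ fv M - x
  fv-rename M x w w∉ = begin
    fv (M [ x := v w ]) - w              ≡⟨ cong (_- w) (fv-∙ M (ι , x := v w)) ⟩
    concatFv (ι , x := v w) (fv M) - w   ≡⟨ concatFv-update ι x w (fv M) w∉′ ⟩
    concatFv ι (fv M - x)                ≡⟨ concatFv-ι (fv M - x) ⟩
    fv M - x                             ∎
    where w∉′ = subst (w ∉_) (sym (concatFv-ι (fv M - x))) w∉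

  module SameBody {x x' M M' w} (w∉ : w ∉ fv M - x) (w∉' : w ∉ fv M' - x')
                  (eq : M [ x := v w ] ≡ M' [ x' := v w ]) where

    bound-≡ : fv M - x ≡ fv M' - x'
    bound-≡ = begin
      fv M - x                    ≡⟨ fv-rename M x w w∉ ⟨
      fv (M [ x := v w ]) - w     ≡⟨ cong (λ t → fv t - w) eq ⟩
      fv (M' [ x' := v w ]) - w   ≡⟨ fv-rename M' x' w w∉' ⟩
      fv M' - x'                  ∎

    update-≡-update : ∀ σ N → M ∙ (σ , x := N) ≡ M' ∙ (σ , x' := N)
    update-≡-update σ N = begin
      M ∙ (σ , x := N)                    ≡⟨ ∙-rename M x w w∉ σ N ⟩
      (M [ x := v w ]) ∙ (σ , w := N)     ≡⟨ cong (_∙ (σ , w := N)) eq ⟩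
      (M' [ x' := v w ]) ∙ (σ , w := N)   ≡⟨ ∙-rename M' x' w w∉' σ N ⟨
      M' ∙ (σ , x' := N)                  ∎

    fresh-≡ : ∀ σ → fresh σ x M ≡ fresh σ x' M'
    fresh-≡ σ = cong (X σ) bound-≡

    lift-≡ : ∀ σ → M ∙ lift σ x M ≡ M' ∙ lift σ x' M'
    lift-≡ σ = trans (update-≡-update σ _) (cong (λ y → M' ∙ (σ , x' := v y)) (fresh-≡ σ))

  ∼α⇒∙-≡ : M ∼α N → ∀ σ → M ∙ σ ≡ N ∙ σ
  ∼α⇒∙-≡ (α-c k) σ = refl
  ∼α⇒∙-≡ (α-v x) σ = refl
  ∼α⇒∙-≡ (α-app M∼ N∼) σ = cong₂ app (∼α⇒∙-≡ M∼ σ) (∼α⇒∙-≡ N∼ σ)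
  ∼α⇒∙-≡ (α-lam {x} {x'} {M = M} {M'} w A∼ w∉ w∉' eq) σ =
    cong₃ lam (fresh-≡ σ) (∼α⇒∙-≡ A∼ σ) (lift-≡ σ)
    where open SameBody {x} {x'} {M} {M'} w∉ w∉' eq
  ∼α⇒∙-≡ (α-pi {x} {x'} {B = B} {B'} w A∼ w∉ w∉' eq) σ =
    cong₃ pi (fresh-≡ σ) (∼α⇒∙-≡ A∼ σ) (lift-≡ σ)
    where open SameBody {x} {x'} {B} {B'} w∉ w∉' eq

  lam-injective : ∀ {y y' A A' M M'} → lam y A M ≡ lam y' A' M' → y ≡ y' × A ≡ A' × M ≡ M'
  lam-injective refl = refl , refl , refl

  pi-injective : ∀ {y y' A A' B B'} → pi y A B ≡ pi y' A' B' → y ≡ y' × A ≡ A' × B ≡ B'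
  pi-injective refl = refl , refl , refl

  app-injective : ∀ {M M' N N'} → app M N ≡ app M' N' → M ≡ M' × N ≡ N'
  app-injective refl = refl , refl

  ∙ι-≡⇒∼α : ∀ M N → M ∙ ι ≡ N ∙ ι → M ∼α N
  ∙ι-≡⇒∼α (c k) (c .k) refl = α-c k
  ∙ι-≡⇒∼α (v x) (v .x) refl = α-v x
  ∙ι-≡⇒∼α (app M N) (app M' N') eq with app-injective eq
  ... | eqᴹ , eqᴺ = α-app (∙ι-≡⇒∼α M M' eqᴹ) (∙ι-≡⇒∼α N N' eqᴺ)
  ∙ι-≡⇒∼α (lam x A M) (lam x' A' M') eq with lam-injective eq
  ... | eqʸ , eqᴬ , eqᴹ =
    α-lam _ (∙ι-≡⇒∼α A A' eqᴬ) (fresh-ι-∉ x M) (subst (_∉ fv M' - x') (sym eqʸ) (fresh-ι-∉ x' M'))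
          (trans eqᴹ (cong (λ y → M' [ x' := v y ]) (sym eqʸ)))
  ∙ι-≡⇒∼α (pi x A B) (pi x' A' B') eq with pi-injective eq
  ... | eqʸ , eqᴬ , eqᴮ =
    α-pi _ (∙ι-≡⇒∼α A A' eqᴬ) (fresh-ι-∉ x B) (subst (_∉ fv B' - x') (sym eqʸ) (fresh-ι-∉ x' B'))
         (trans eqᴮ (cong (λ y → B' [ x' := v y ]) (sym eqʸ)))
  ∙ι-≡⇒∼α (c _) (v _) ()
  ∙ι-≡⇒∼α (c _) (lam _ _ _) ()
  ∙ι-≡⇒∼α (c _) (pi _ _ _) ()
  ∙ι-≡⇒∼α (c _) (app _ _) ()
  ∙ι-≡⇒∼α (v _) (c _) ()
  ∙ι-≡⇒∼α (v _) (lam _ _ _) ()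
  ∙ι-≡⇒∼α (v _) (pi _ _ _) ()
  ∙ι-≡⇒∼α (v _) (app _ _) ()
  ∙ι-≡⇒∼α (app _ _) (c _) ()
  ∙ι-≡⇒∼α (app _ _) (v _) ()
  ∙ι-≡⇒∼α (app _ _) (lam _ _ _) ()
  ∙ι-≡⇒∼α (app _ _) (pi _ _ _) ()
  ∙ι-≡⇒∼α (lam _ _ _) (c _) ()
  ∙ι-≡⇒∼α (lam _ _ _) (v _) ()
  ∙ι-≡⇒∼α (lam _ _ _) (pi _ _ _) ()
  ∙ι-≡⇒∼α (lam _ _ _) (app _ _) ()
  ∙ι-≡⇒∼α (pi _ _ _) (c _) ()
  ∙ι-≡⇒∼α (pi _ _ _) (v _) ()
  ∙ι-≡⇒∼α (pi _ _ _) (lam _ _ _) ()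
  ∙ι-≡⇒∼α (pi _ _ _) (app _ _) ()

  ∼α-refl : M ∼α M
  ∼α-refl {M} = ∙ι-≡⇒∼α M M refl

  ∼α-sym : M ∼α N → N ∼α M
  ∼α-sym M∼N = ∙ι-≡⇒∼α _ _ (sym (∼α⇒∙-≡ M∼N ι))

  ∼α⇒≃β : M ∼α N → M ≃β N
  ∼α⇒≃β M∼N = return (inj₁ M∼N)

  ∙-cong-∼α : ∀ M {σ τ} → (∀ u → σ u ∼α τ u) → (M ∙ σ) ∼α (M ∙ τ)
  ∙-cong-∼α M {σ} {τ} σ∼τ = ∙ι-≡⇒∼α _ _ (begin
    (M ∙ σ) ∙ ι   ≡⟨ ∙-⨟ M σ ι ⟩
    M ∙ (σ ⨟ ι)   ≡⟨ ∙-cong M _ _ (λ u _ → ∼α⇒∙-≡ (σ∼τ u) ι) ⟩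
    M ∙ (τ ⨟ ι)   ≡⟨ ∙-⨟ M τ ι ⟨
    (M ∙ τ) ∙ ι   ∎)

  [:=]-cong-∼α : ∀ B x {N N'} → N ∼α N' → (B [ x := N ]) ∼α (B [ x := N' ])
  [:=]-cong-∼α B x {N} {N'} N∼N' = ∙-cong-∼α B pointwise
    where
    pointwise : ∀ u → (ι , x := N) u ∼α (ι , x := N') u
    pointwise u with u ≟V x
    ... | yes _ = N∼N'
    ... | no  _ = ∼α-refl

  pi-dom-∼α : ∀ y {A A'} B → A ∼α A' → pi y A B ∼α pi y A' B
  pi-dom-∼α y B A∼A' = α-pi (fresh ι y B) A∼A' (fresh-ι-∉ y B) (fresh-ι-∉ y B) refl

  lam-body-∼α : ∀ {x x' A A' M M'} → lam x A M ∼α lam x' A' M' →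
                ∀ z → (M [ x := v z ]) ∼α (M' [ x' := v z ])
  lam-body-∼α {x} {x'} {M = M} {M'} (α-lam _ _ w∉ w∉' eq) z =
    ∙ι-≡⇒∼α _ _ (cong (_∙ ι) (update-≡-update ι (v z)))
    where open SameBody {x} {x'} {M} {M'} w∉ w∉' eq

  pi-body-∼α : ∀ {x x' A A' B B'} → pi x A B ∼α pi x' A' B' →
               ∀ z → (B [ x := v z ]) ∼α (B' [ x' := v z ])
  pi-body-∼α {x} {x'} {B = B} {B'} (α-pi _ _ w∉ w∉' eq) z =
    ∙ι-≡⇒∼α _ _ (cong (_∙ ι) (update-≡-update ι (v z)))
    where open SameBody {x} {x'} {B} {B'} w∉ w∉' eq

  ≈α-dom : Γ ≈α Δ → dom Γ ≡ dom Δ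
  ≈α-dom [] = refl
  ≈α-dom ((x≡y , _) ∷ Γ≈Δ) = cong₂ _∷_ x≡y (≈α-dom Γ≈Δ)

  ≈α-∉ : ∀ {y} → Γ ≈α Δ → y ∉ dom Δ → y ∉ dom Γ
  ≈α-∉ Γ≈Δ = subst (_ ∉_) (sym (≈α-dom Γ≈Δ))

  ∈-≈α : ∀ {x} → Γ ≈α Δ → (x , A) ∈ Γ → ∃[ A' ] (x , A') ∈ Δ × A ∼α A'
  ∈-≈α ((refl , A∼A') ∷ _) (here refl) = _ , here refl , A∼A'
  ∈-≈α (_ ∷ Γ≈Δ) (there x∈) = map₂ (map₁ there) (∈-≈α Γ≈Δ x∈)

  ⊢-weaken : Γ ⊢ M ∶ A → Γ ⊆ Δ → Δ ok → Δ ⊢ M ∶ A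
  ⊢-weaken (sort _ ax) Γ⊆Δ Δok = sort Δok ax
  ⊢-weaken (var _ x∈) Γ⊆Δ Δok = var Δok (Γ⊆Δ x∈)
  ⊢-weaken (appT ⊢M ⊢N ⊢B) Γ⊆Δ Δok =
    appT (⊢-weaken ⊢M Γ⊆Δ Δok) (⊢-weaken ⊢N Γ⊆Δ Δok) (⊢-weaken ⊢B Γ⊆Δ Δok)
  ⊢-weaken (conv ⊢M A≃B ⊢B) Γ⊆Δ Δok = conv (⊢-weaken ⊢M Γ⊆Δ Δok) A≃B (⊢-weaken ⊢B Γ⊆Δ Δok)
  ⊢-weaken {Γ} {Δ = Δ} (prod ⊢A ⊢B r) Γ⊆Δ Δok =
    prod ⊢A' (λ y y∉ → ⊢-weaken (⊢B y (dom-⊆ y∉)) (∷⁺ʳ _ Γ⊆Δ) (cons Δok ⊢A' y∉)) r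
    where ⊢A' = ⊢-weaken ⊢A Γ⊆Δ Δok
          dom-⊆ : ∀ {y} → y ∉ dom Δ → y ∉ dom Γ
          dom-⊆ y∉ y∈ = y∉ (map⁺ proj₁ Γ⊆Δ y∈)
  ⊢-weaken {Γ} {Δ = Δ} (abs ⊢A ⊢B ⊢M r) Γ⊆Δ Δok =
    abs ⊢A' (λ z z∉ → ⊢-weaken (⊢B z (dom-⊆ z∉)) (∷⁺ʳ _ Γ⊆Δ) (cons Δok ⊢A' z∉))
            (λ z z∉ → ⊢-weaken (⊢M z (dom-⊆ z∉)) (∷⁺ʳ _ Γ⊆Δ) (cons Δok ⊢A' z∉)) r
    where ⊢A' = ⊢-weaken ⊢A Γ⊆Δ Δok
          dom-⊆ : ∀ {y} → y ∉ dom Δ → y ∉ dom Γ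
          dom-⊆ y∉ y∈ = y∉ (map⁺ proj₁ Γ⊆Δ y∈)

  mutual
    ok-≈α : Γ ≈α Δ → Γ ok → Δ ok
    ok-≈α [] nil = nil
    ok-≈α ((refl , A∼A') ∷ Γ≈Δ) (cons Γok ⊢A x∉) =
      cons (ok-≈α Γ≈Δ Γok) (⊢-≈α Γ≈Δ A∼A' ⊢A) (subst (_ ∉_) (≈α-dom Γ≈Δ) x∉)

    -- Part of the mutual induction because the sorting of an entry lies inside the ok-derivation,
    -- hence below the var rule that needs it.
    entry-≈α : ∀ {x} → Γ ≈α Δ → Γ ok → (x , A) ∈ Γ → ∃[ s ] Δ ⊢ A ∶ c s
    entry-≈α Γ≈Δ@((refl , _) ∷ Γ'≈Δ') Γok@(cons _ ⊢A _) (here refl) =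
      _ , ⊢-weaken (⊢-≈α Γ'≈Δ' ∼α-refl ⊢A) there (ok-≈α Γ≈Δ Γok)
    entry-≈α Γ≈Δ@(_ ∷ Γ'≈Δ') Γok@(cons Γ'ok _ _) (there x∈) =
      map₂ (λ ⊢A → ⊢-weaken ⊢A there (ok-≈α Γ≈Δ Γok)) (entry-≈α Γ'≈Δ' Γ'ok x∈)

    ⊢-≈α : Γ ≈α Δ → M ∼α N → Γ ⊢ M ∶ A → Δ ⊢ N ∶ A
    ⊢-≈α Γ≈Δ M∼N (conv ⊢M A≃B ⊢B) = conv (⊢-≈α Γ≈Δ M∼N ⊢M) A≃B (⊢-≈α Γ≈Δ ∼α-refl ⊢B)
    ⊢-≈α Γ≈Δ (α-c k) (sort Γok ax) = sort (ok-≈α Γ≈Δ Γok) ax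
    ⊢-≈α Γ≈Δ (α-v x) (var Γok x∈) with ∈-≈α Γ≈Δ x∈ | entry-≈α Γ≈Δ Γok x∈
    ... | _ , x∈' , A∼A' | _ , ⊢A = conv (var (ok-≈α Γ≈Δ Γok) x∈') (∼α⇒≃β (∼α-sym A∼A')) ⊢A
    ⊢-≈α Γ≈Δ pi∼@(α-pi _ A∼A' _ _ _) (prod ⊢A ⊢B r) =
      prod (⊢-≈α Γ≈Δ A∼A' ⊢A)
           (λ y y∉ → ⊢-≈α ((refl , A∼A') ∷ Γ≈Δ) (pi-body-∼α pi∼ y) (⊢B y (≈α-∉ Γ≈Δ y∉))) r
    ⊢-≈α Γ≈Δ lam∼@(α-lam _ A∼A' _ _ _) (abs {y = y} {B = B} ⊢A ⊢B ⊢M r) =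
      conv (abs (⊢-≈α Γ≈Δ A∼A' ⊢A)
                (λ z z∉ → ⊢-≈α ((refl , A∼A') ∷ Γ≈Δ) ∼α-refl (⊢B z (≈α-∉ Γ≈Δ z∉)))
                (λ z z∉ → ⊢-≈α ((refl , A∼A') ∷ Γ≈Δ) (lam-body-∼α lam∼ z) (⊢M z (≈α-∉ Γ≈Δ z∉))) r)
           (∼α⇒≃β (pi-dom-∼α y B (∼α-sym A∼A')))
           (prod (⊢-≈α Γ≈Δ ∼α-refl ⊢A)
                 (λ z z∉ → ⊢-≈α ((refl , ∼α-refl) ∷ Γ≈Δ) ∼α-refl (⊢B z (≈α-∉ Γ≈Δ z∉))) r)
    ⊢-≈α Γ≈Δ (α-app {N = N} M∼M' N∼N') (appT {x = x} {B = B} ⊢M ⊢N ⊢B) =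
      conv (appT (⊢-≈α Γ≈Δ M∼M' ⊢M) (⊢-≈α Γ≈Δ N∼N' ⊢N) (⊢-≈α Γ≈Δ B[N]∼B[N'] ⊢B))
           (∼α⇒≃β (∼α-sym B[N]∼B[N']))
           (⊢-≈α Γ≈Δ ∼α-refl ⊢B)
      where B[N]∼B[N'] = [:=]-cong-∼α B x N∼N'

lemma18 : (S : Setting) → let open PTS S in
    (∀ (Γ Δ : Context) → Γ ≈α Δ → Γ ok → Δ ok)
    × (∀ (Γ Δ : Context) (M N A : Term) → Γ ≈α Δ → M ∼α N → Γ ⊢ M ∶ A → Δ ⊢ N ∶ A)
lemma18 S = (λ _ _ → ok-≈α) , (λ _ _ _ _ _ → ⊢-≈α)
  where open AlphaInvariance S
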